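{- Let $u,v$ be integers with $u\ge v\ge 2$ and let $\Psi(u,v)=(u_1,\dots,u_v)$. Then (i) $\sum_{i=1}^v u_i=u$; (ii) for every $i\in\{1,\dots,v-1\}$, $u_i\in\left\{\sum_{j=i+1}^v u_j,\ \sum_{j=i+1}^v u_j+1\right\}$.
   Context: For integers $u\ge v\ge 2$, $\Psi(u,v):=(u_1,\dots,u_v)$ where $u_1=\lceil u/2\rceil$, $u_i=\left\lceil \lfloor u/2^{i-1}\rfloor/2\right\rceil$ for $i=2,\dots,v-1$, and $u_v=\lfloor u/2^{v-1}\rfloor$. -}

module Defs where

open import Data.Nat using (ℕ; zero; suc; _+_; _∸_; _^_; ⌈_/2⌉; _≟_)
open import Data.Nat.DivMod using (_/_)
open import Data.Nat.Properties using (m^n≢0)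
open import Relation.Nullary using (yes; no)

floorDivPow2 : ℕ → ℕ → ℕ
floorDivPow2 u k = (u / (2 ^ k)) {{m^n≢0 2 k}}

-- i-th component (1-indexed, 1 ≤ i ≤ v) of Ψ(u,v) = (u_1, …, u_v):
--   u_1 = ⌈u/2⌉,
--   u_i = ⌈ ⌊u/2^(i-1)⌋ / 2 ⌉  for 2 ≤ i ≤ v-1,
--   u_v = ⌊u/2^(v-1)⌋.
-- (For v ≥ 2, the case i = 1 never coincides with i = v.)
Ψ : ℕ → ℕ → ℕ → ℕ
Ψ u v i with i ≟ 1
... | yes _ = ⌈ u /2⌉
... | no _ with i ≟ v
...   | yes _ = floorDivPow2 u (v ∸ 1)
...   | no _ = ⌈ floorDivPow2 u (i ∸ 1) /2⌉

-- Σ_{j=a}^{b} f j  for a ≥ 1 (empty, i.e. 0, when b < a); only used with a ≥ 1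
sumFromTo : (ℕ → ℕ) → ℕ → ℕ → ℕ
sumFromTo f a zero = 0
sumFromTo f a (suc b) with a Data.Nat.≤? suc b
... | yes _ = sumFromTo f a b + f (suc b)
... | no _ = 0

-- With F k = ⌊u/2^k⌋ we have F (k+1) = ⌊F k / 2⌋ and ⌈x/2⌉ + ⌊x/2⌋ = x, so the
-- tail sums telescope: u_{k+1} + … + u_v = F k for every k < v, the last
-- component u_v = F (v-1) starting the induction.  Taking k = 0 gives (i); for
-- i < v the component u_i = ⌈F (i-1)/2⌉ exceeds the tail F i = ⌊F (i-1)/2⌋ by
-- 0 or 1, which is (ii).
module Submission where

open import Defs
open import Data.Nat using (ℕ; _≤_; _+_)
open import Data.Product using (_×_)
open import Data.Sum using (_⊎_)
open import Relation.Binary.PropositionalEquality using (_≡_)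

open import Data.Nat using (zero; suc; _*_; _∸_; _^_; _<_; _≤?_; _≟_; ⌊_/2⌋; ⌈_/2⌉; s≤s; z≤n; NonZero)
open import Data.Nat.Properties
open import Data.Nat.DivMod using (_/_; /-congʳ; n/1≡n; m/n/o≡m/[n*o]; m/n≡1+[m∸n]/n)
open import Data.Product using (_,_)
open import Data.Sum using (inj₁; inj₂)
open import Relation.Nullary using (yes; no; contradiction)
open import Relation.Binary.PropositionalEquality using (_≢_; refl; sym; trans; cong; cong₂; subst₂; module ≡-Reasoning)

open ≡-Reasoning

n/2≡⌊n/2⌋ : ∀ n → n / 2 ≡ ⌊ n /2⌋
n/2≡⌊n/2⌋ zero          = refl
n/2≡⌊n/2⌋ (suc zero)    = refl
n/2≡⌊n/2⌋ (suc (suc n)) = trans (m/n≡1+[m∸n]/n {suc (suc n)} (s≤s (s≤s z≤n))) (cong suc (n/2≡⌊n/2⌋ n))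

⌈n/2⌉≡⌊n/2⌋⊎⌈n/2⌉≡⌊n/2⌋+1 : ∀ n → ⌈ n /2⌉ ≡ ⌊ n /2⌋ ⊎ ⌈ n /2⌉ ≡ ⌊ n /2⌋ + 1
⌈n/2⌉≡⌊n/2⌋⊎⌈n/2⌉≡⌊n/2⌋+1 zero          = inj₁ refl
⌈n/2⌉≡⌊n/2⌋⊎⌈n/2⌉≡⌊n/2⌋+1 (suc zero)    = inj₂ refl
⌈n/2⌉≡⌊n/2⌋⊎⌈n/2⌉≡⌊n/2⌋+1 (suc (suc n)) with ⌈n/2⌉≡⌊n/2⌋⊎⌈n/2⌉≡⌊n/2⌋+1 n
... | inj₁ eq = inj₁ (cong suc eq)
... | inj₂ eq = inj₂ (cong suc eq)

floorDivPow2-zero : ∀ u → floorDivPow2 u 0 ≡ u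
floorDivPow2-zero = n/1≡n

floorDivPow2-suc : ∀ u k → floorDivPow2 u (suc k) ≡ ⌊ floorDivPow2 u k /2⌋
floorDivPow2-suc u k = begin
  u / (2 * 2 ^ k) ≡⟨ /-congʳ (*-comm 2 (2 ^ k)) ⟩
  u / (2 ^ k * 2) ≡⟨ m/n/o≡m/[n*o] u (2 ^ k) 2 ⟨
  u / 2 ^ k / 2   ≡⟨ n/2≡⌊n/2⌋ (u / 2 ^ k) ⟩
  ⌊ u / 2 ^ k /2⌋ ∎
  where
  instance
    2^k≢0 : NonZero (2 ^ k)
    2^k≢0 = m^n≢0 2 k
    2^[1+k]≢0 : NonZero (2 ^ suc k)
    2^[1+k]≢0 = m^n≢0 2 (suc k)
    2^k*2≢0 : NonZero (2 ^ k * 2)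
    2^k*2≢0 = m*n≢0 (2 ^ k) 2

module _ (f : ℕ → ℕ) where

  sumFromTo-empty : ∀ {a b} → b < a → sumFromTo f a b ≡ 0
  sumFromTo-empty {b = zero} _ = refl
  sumFromTo-empty {a} {suc b} b<a with a ≤? suc b
  ... | yes a≤b = contradiction a≤b (<⇒≱ b<a)
  ... | no _    = refl

  sumFromTo-snoc : ∀ {a b} → a ≤ suc b → sumFromTo f a (suc b) ≡ sumFromTo f a b + f (suc b)
  sumFromTo-snoc {a} {b} a≤1+b with a ≤? suc b
  ... | yes _   = refl
  ... | no a≰b  = contradiction a≤1+b a≰b

  sumFromTo-singleton : ∀ a → sumFromTo f (suc a) (suc a) ≡ f (suc a)
  sumFromTo-singleton a = begin
    sumFromTo f (suc a) (suc a)        ≡⟨ sumFromTo-snoc ≤-refl ⟩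
    sumFromTo f (suc a) a + f (suc a)  ≡⟨ cong (_+ f (suc a)) (sumFromTo-empty (n<1+n a)) ⟩
    f (suc a)                          ∎

  sumFromTo-cons : ∀ {a b} → suc a ≤ b →
                   sumFromTo f (suc a) b ≡ f (suc a) + sumFromTo f (suc (suc a)) b
  sumFromTo-cons {a} {suc b} (s≤s a≤b) with m≤n⇒m<n∨m≡n a≤b
  ... | inj₂ refl = begin
    sumFromTo f (suc a) (suc a)                    ≡⟨ sumFromTo-singleton a ⟩
    f (suc a)                                      ≡⟨ +-identityʳ (f (suc a)) ⟨
    f (suc a) + 0                                  ≡⟨ cong (f (suc a) +_) (sumFromTo-empty (n<1+n (suc a))) ⟨
    f (suc a) + sumFromTo f (suc (suc a)) (suc a)  ∎
  ... | inj₁ a<b = begin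
    sumFromTo f (suc a) (suc b)                              ≡⟨ sumFromTo-snoc (s≤s a≤b) ⟩
    sumFromTo f (suc a) b + f (suc b)                        ≡⟨ cong (_+ f (suc b)) (sumFromTo-cons a<b) ⟩
    f (suc a) + sumFromTo f (suc (suc a)) b + f (suc b)      ≡⟨ +-assoc (f (suc a)) _ _ ⟩
    f (suc a) + (sumFromTo f (suc (suc a)) b + f (suc b))    ≡⟨ cong (f (suc a) +_) (sumFromTo-snoc (s≤s a<b)) ⟨
    f (suc a) + sumFromTo f (suc (suc a)) (suc b)            ∎

Ψ-inner : ∀ u v k → suc k ≢ v → Ψ u v (suc k) ≡ ⌈ floorDivPow2 u k /2⌉
Ψ-inner u v zero    _      = cong ⌈_/2⌉ (sym (floorDivPow2-zero u))
Ψ-inner u v (suc k) 2+k≢v with suc (suc k) ≟ v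
... | yes 2+k≡v = contradiction 2+k≡v 2+k≢v
... | no _      = refl

Ψ-last : ∀ u v → v ≢ 1 → Ψ u v v ≡ floorDivPow2 u (v ∸ 1)
Ψ-last u v v≢1 with v ≟ 1
... | yes v≡1 = contradiction v≡1 v≢1
... | no _ with v ≟ v
...   | yes _   = refl
...   | no v≢v  = contradiction refl v≢v

Ψ-tailSum : ∀ u {v} d k → v ≢ 1 → d + suc k ≡ v →
            sumFromTo (Ψ u v) (suc k) v ≡ floorDivPow2 u k
Ψ-tailSum u zero    k v≢1 refl = trans (sumFromTo-singleton (Ψ u (suc k)) k) (Ψ-last u (suc k) v≢1)
Ψ-tailSum u (suc d) k v≢1 refl = begin
  sumFromTo f (suc k) v                    ≡⟨ sumFromTo-cons f {k} (m≤n+m (suc k) (suc d)) ⟩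
  f (suc k) + sumFromTo f (suc (suc k)) v  ≡⟨ cong₂ _+_ (Ψ-inner u v k (m≢1+n+m (suc k))) tail ⟩
  ⌈ F /2⌉ + floorDivPow2 u (suc k)         ≡⟨ cong (⌈ F /2⌉ +_) (floorDivPow2-suc u k) ⟩
  ⌈ F /2⌉ + ⌊ F /2⌋                        ≡⟨ +-comm ⌈ F /2⌉ ⌊ F /2⌋ ⟩
  ⌊ F /2⌋ + ⌈ F /2⌉                        ≡⟨ ⌊n/2⌋+⌈n/2⌉≡n F ⟩
  F                                        ∎
  where
  v : ℕ
  v = suc (d + suc k)
  f : ℕ → ℕ
  f = Ψ u v
  F : ℕ
  F = floorDivPow2 u k
  tail : sumFromTo f (suc (suc k)) v ≡ floorDivPow2 u (suc k)
  tail = Ψ-tailSum u d (suc k) v≢1 (+-suc d (suc k))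

proposition2p3 : (u v : ℕ) → 2 ≤ v → v ≤ u →
    (sumFromTo (Ψ u v) 1 v ≡ u)
    × ((i : ℕ) → 1 ≤ i → i ≤ v Data.Nat.∸ 1 →
        (Ψ u v i ≡ sumFromTo (Ψ u v) (i + 1) v)
        ⊎ (Ψ u v i ≡ sumFromTo (Ψ u v) (i + 1) v + 1))
proposition2p3 u (suc zero) (s≤s ()) _
proposition2p3 u v@(suc (suc w)) _ _ = trans (tailSum 0 (s≤s z≤n)) (floorDivPow2-zero u) , neighbours
  where
  tailSum : ∀ k → suc k ≤ v → sumFromTo (Ψ u v) (suc k) v ≡ floorDivPow2 u k
  tailSum k k<v = Ψ-tailSum u (v ∸ suc k) k (λ ()) (m∸n+n≡m k<v)

  neighbours : (i : ℕ) → 1 ≤ i → i ≤ v ∸ 1 →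
    (Ψ u v i ≡ sumFromTo (Ψ u v) (i + 1) v) ⊎ (Ψ u v i ≡ sumFromTo (Ψ u v) (i + 1) v + 1)
  neighbours (suc k) _ k<1+w =
    subst₂ (λ x y → x ≡ y ⊎ x ≡ y + 1) (sym component) (sym tail) (⌈n/2⌉≡⌊n/2⌋⊎⌈n/2⌉≡⌊n/2⌋+1 F)
    where
    F : ℕ
    F = floorDivPow2 u k
    component : Ψ u v (suc k) ≡ ⌈ F /2⌉
    component = Ψ-inner u v k (<⇒≢ (s≤s k<1+w))
    tail : sumFromTo (Ψ u v) (suc k + 1) v ≡ ⌊ F /2⌋
    tail = begin
      sumFromTo (Ψ u v) (suc k + 1) v    ≡⟨ cong (λ a → sumFromTo (Ψ u v) a v) (+-comm (suc k) 1) ⟩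
      sumFromTo (Ψ u v) (suc (suc k)) v  ≡⟨ tailSum (suc k) (s≤s k<1+w) ⟩
      floorDivPow2 u (suc k)             ≡⟨ floorDivPow2-suc u k ⟩
      ⌊ F /2⌋                            ∎
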